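{- Let $B>0$ and for an integer $k\ge1$ and a finite set $U$ define $f_k:2^U\to\mathbb{R}$ by $f_k(S)=B$ if $|S|\ge k$ and $f_k(S)=0$ otherwise. Then (1) for $k=1$ and $k=2$, $f_k$ is weakly submodular; (2) for every $k\ge3$, $f_k$ is not weakly submodular on any universe $U$ with $|U|\ge k$.
   Context: A normalized ($f(\emptyset)=0$), non-negative set function $f$ on a finite universe $U$ is called weakly submodular if for all $S,T\subseteq U$: $|T|f(S)+|S|f(T)\ge |S\cap T|\,f(S\cup T)+|S\cup T|\,f(S\cap T)$.
   Formalization: The constant $B$ ranges over the positive rationals instead of the positive reals, so the functions $f_k$ take values in ℚ. -}

module Defs where

open import Data.Nat using (ℕ; _≤ᵇ_)
open import Data.Integer using (+_)
open import Data.Rational using (ℚ; 0ℚ; _+_; _*_; _≤_; _/_)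
open import Data.Fin.Subset using (Subset; ⊥; ∣_∣; _∩_; _∪_)
open import Data.Bool using (if_then_else_)
open import Data.Product using (_×_)
open import Relation.Binary.PropositionalEquality using (_≡_)

ℕ→ℚ : ℕ → ℚ
ℕ→ℚ m = + m / 1

SetFun : ℕ → Set
SetFun n = Subset n → ℚ

WeaklySubmodular : (n : ℕ) → SetFun n → Set
WeaklySubmodular n f =
  (f ⊥ ≡ 0ℚ) ×
  ((S : Subset n) → 0ℚ ≤ f S) ×
  ((S T : Subset n) →
     (ℕ→ℚ ∣ S ∩ T ∣ * f (S ∪ T)) + (ℕ→ℚ ∣ S ∪ T ∣ * f (S ∩ T))
       ≤ (ℕ→ℚ ∣ T ∣ * f S) + (ℕ→ℚ ∣ S ∣ * f T))

threshold : (B : ℚ) (k : ℕ) {n : ℕ} → SetFun n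
threshold B k S = if k ≤ᵇ ∣ S ∣ then B else 0ℚ

{-# OPTIONS --safe #-}
module Submission where

-- Dividing by B, the inequality for f_k at S, T becomes an inequality between the
-- natural numbers a = |S ∩ T|, u = |S ∪ T|, s = |S|, t = |T|, where a + u = s + t.
-- It can only fail when s, t < k ≤ u and a ≥ 1, i.e. when S and T straddle the
-- threshold (both lie below it, S ∪ T reaches it) and S ∩ T ≠ ∅. Then a + k ≤ a + u = s + t ≤ 2k - 2,
-- so 1 ≤ a ≤ k - 2: impossible for k ≤ 2, and attained for k ≥ 3 by
-- S = {0} ∪ P, T = {1} ∪ P with |P| = k - 2.

open import Defs
open import Data.Nat using (ℕ) renaming (_≤_ to _≤ℕ_)
open import Data.Rational using (ℚ; 0ℚ; _<_)
open import Data.Product using (_×_)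
open import Relation.Nullary using (¬_)

open import Data.Bool using (Bool; true; false; if_then_else_)
open import Data.Empty using (⊥-elim)
open import Data.Fin.Subset using (Subset; ⊥; ∣_∣; _∩_; _∪_; inside; outside)
open import Data.Fin.Subset.Properties using (∣⊥∣≡0; ∩-idem; ∪-idem; ∣p∩q∣≤∣p∣; ∣p∩q∣≤∣q∣; ∣p∣≤∣p∪q∣)
import Data.Integer as ℤ
import Data.Integer.Properties as ℤₚ
open import Data.Nat using (suc; _+_; _*_; _≤ᵇ_; z≤n; s≤s)
  renaming (_<_ to _<ℕ_)
open import Data.Nat.Coprimality using (1-coprimeTo) renaming (sym to coprime-sym)
open import Data.Nat.Properties
open import Data.Product using (Σ-syntax; _,_)
open import Data.Rational using (mkℚ; *≤*; positive)
import Data.Rational as ℚ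
import Data.Rational.Properties as ℚₚ
open import Data.Sum using (inj₁; inj₂)
open import Data.Vec using ([]; _∷_)
open import Function using (_⇔_; mk⇔; Equivalence)
open import Relation.Binary.PropositionalEquality

ℕ→ℚ≡mkℚ : ∀ m → ℕ→ℚ m ≡ mkℚ (ℤ.+ m) 0 (coprime-sym (1-coprimeTo m))
ℕ→ℚ≡mkℚ m = ℚₚ.normalize-coprime (coprime-sym (1-coprimeTo m))

ℕ→ℚ-+ : ∀ m n → ℕ→ℚ (m + n) ≡ ℕ→ℚ m ℚ.+ ℕ→ℚ n
ℕ→ℚ-+ m n rewrite ℕ→ℚ≡mkℚ m | ℕ→ℚ≡mkℚ n =
  cong (ℚ._/ 1) (trans (ℤₚ.pos-+ m n)
    (sym (cong₂ ℤ._+_ (ℤₚ.*-identityʳ (ℤ.+ m)) (ℤₚ.*-identityʳ (ℤ.+ n)))))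

ℕ→ℚ-mono-≤ : ∀ {m n} → m ≤ℕ n → ℕ→ℚ m ℚ.≤ ℕ→ℚ n
ℕ→ℚ-mono-≤ {m} {n} m≤n rewrite ℕ→ℚ≡mkℚ m | ℕ→ℚ≡mkℚ n =
  *≤* (ℤₚ.*-monoʳ-≤-nonNeg (ℤ.+ 1) (ℤ.+≤+ m≤n))

ℕ→ℚ-cancel-≤ : ∀ {m n} → ℕ→ℚ m ℚ.≤ ℕ→ℚ n → m ≤ℕ n
ℕ→ℚ-cancel-≤ {m} {n} le rewrite ℕ→ℚ≡mkℚ m | ℕ→ℚ≡mkℚ n with le
... | *≤* m*1≤n*1 = ℤₚ.drop‿+≤+ (ℤₚ.*-cancelʳ-≤-pos (ℤ.+ m) (ℤ.+ n) (ℤ.+ 1) m*1≤n*1)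

_when_ : ℕ → Bool → ℕ
x when b = if b then x else 0

x-when-≤ᵇ≡x : ∀ x {k m} → k ≤ℕ m → (x when (k ≤ᵇ m)) ≡ x
x-when-≤ᵇ≡x x {k} {m} k≤m with k ≤ᵇ m | ≤⇒≤ᵇ k≤m
... | true | _ = refl

x-when-≤ᵇ≡0 : ∀ x {k m} → m <ℕ k → (x when (k ≤ᵇ m)) ≡ 0
x-when-≤ᵇ≡0 x {k} {m} m<k with k ≤ᵇ m | ≤ᵇ⇒≤ k m
... | false | _ = refl
... | true | k≤m = ⊥-elim (<⇒≱ m<k (k≤m _))

x-when-b≤x : ∀ x b → x when b ≤ℕ x
x-when-b≤x x true = ≤-refl
x-when-b≤x x false = z≤n

ThresholdInequality : (k a u s t : ℕ) → Set
ThresholdInequality k a u s t =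
  (a when (k ≤ᵇ u)) + (u when (k ≤ᵇ a)) ≤ℕ (t when (k ≤ᵇ s)) + (s when (k ≤ᵇ t))

straddle⇒2+a≤k : ∀ {k a u s t} → a + u ≡ s + t → s <ℕ k → t <ℕ k → k ≤ℕ u → 2 + a ≤ℕ k
straddle⇒2+a≤k {k} {a} {u} {s} {t} a+u≡s+t s<k t<k k≤u = +-cancelʳ-≤ k (2 + a) k (begin
  2 + a + k      ≤⟨ +-monoʳ-≤ (2 + a) k≤u ⟩
  2 + (a + u)    ≡⟨ cong (λ x → 2 + x) a+u≡s+t ⟩
  2 + (s + t)    ≡⟨ cong suc (sym (+-suc s t)) ⟩
  suc s + suc t  ≤⟨ +-mono-≤ s<k t<k ⟩
  k + k          ∎)
  where open ≤-Reasoning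

straddle⇒a≡0 : ∀ {k a u s t} → k ≤ℕ 2 → a + u ≡ s + t → s <ℕ k → t <ℕ k → k ≤ℕ u → a ≡ 0
straddle⇒a≡0 k≤2 a+u≡s+t s<k t<k k≤u =
  n≤0⇒n≡0 (+-cancelʳ-≤ 2 _ 0 (≤-trans (≤-reflexive (+-comm _ 2))
    (≤-trans (straddle⇒2+a≤k a+u≡s+t s<k t<k k≤u) k≤2)))

thresholdInequality : ∀ {k a u s t} → a + u ≡ s + t → a ≤ℕ s → a ≤ℕ t → s ≤ℕ u →
  (s <ℕ k → t <ℕ k → k ≤ℕ u → a ≡ 0) → ThresholdInequality k a u s t
thresholdInequality {k} {a} {u} {s} {t} a+u≡s+t a≤s a≤t s≤u a≡0-if-straddle
  with ≤-<-connex k a | ≤-<-connex k s | ≤-<-connex k t | ≤-<-connex k u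
... | inj₁ k≤a | _ | _ | _
  rewrite x-when-≤ᵇ≡x a (≤-trans k≤a (≤-trans a≤s s≤u)) | x-when-≤ᵇ≡x u k≤a
        | x-when-≤ᵇ≡x t (≤-trans k≤a a≤s) | x-when-≤ᵇ≡x s (≤-trans k≤a a≤t)
  = ≤-reflexive (trans a+u≡s+t (+-comm s t))
... | inj₂ a<k | inj₁ k≤s | _ | _
  rewrite x-when-≤ᵇ≡0 u a<k | +-identityʳ (a when (k ≤ᵇ u)) | x-when-≤ᵇ≡x t k≤s
  = ≤-trans (x-when-b≤x a _) (≤-trans a≤t (m≤m+n t _))
... | inj₂ a<k | inj₂ _ | inj₁ k≤t | _
  rewrite x-when-≤ᵇ≡0 u a<k | +-identityʳ (a when (k ≤ᵇ u)) | x-when-≤ᵇ≡x s k≤t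
  = ≤-trans (x-when-b≤x a _) (≤-trans a≤s (m≤n+m s _))
... | inj₂ a<k | inj₂ s<k | inj₂ t<k | inj₁ k≤u
  rewrite x-when-≤ᵇ≡0 u a<k | x-when-≤ᵇ≡x a k≤u | a≡0-if-straddle s<k t<k k≤u
  = z≤n
... | inj₂ a<k | inj₂ _ | inj₂ _ | inj₂ u<k
  rewrite x-when-≤ᵇ≡0 u a<k | x-when-≤ᵇ≡0 a u<k
  = z≤n

¬thresholdInequality : ∀ {k a u s t} → s <ℕ k → t <ℕ k → k ≤ℕ u → 1 ≤ℕ a →
  ¬ ThresholdInequality k a u s t
¬thresholdInequality {a = a} {s = s} {t = t} s<k t<k k≤u 1≤a
  rewrite x-when-≤ᵇ≡x a k≤u | x-when-≤ᵇ≡0 t s<k | x-when-≤ᵇ≡0 s t<k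
  = λ a+⋯≤0 → <⇒≱ 1≤a (≤-trans (m≤m+n a _) a+⋯≤0)

∣p∩q∣+∣p∪q∣≡∣p∣+∣q∣ : ∀ {n} (p q : Subset n) → ∣ p ∩ q ∣ + ∣ p ∪ q ∣ ≡ ∣ p ∣ + ∣ q ∣
∣p∩q∣+∣p∪q∣≡∣p∣+∣q∣ [] [] = refl
∣p∩q∣+∣p∪q∣≡∣p∣+∣q∣ (true ∷ p) (true ∷ q) = cong suc (begin
  ∣ p ∩ q ∣ + suc ∣ p ∪ q ∣  ≡⟨ +-suc _ _ ⟩
  suc (∣ p ∩ q ∣ + ∣ p ∪ q ∣) ≡⟨ cong suc (∣p∩q∣+∣p∪q∣≡∣p∣+∣q∣ p q) ⟩
  suc (∣ p ∣ + ∣ q ∣)         ≡⟨ +-suc _ _ ⟨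
  ∣ p ∣ + suc ∣ q ∣           ∎)
  where open ≡-Reasoning
∣p∩q∣+∣p∪q∣≡∣p∣+∣q∣ (true ∷ p) (false ∷ q) =
  trans (+-suc _ _) (cong suc (∣p∩q∣+∣p∪q∣≡∣p∣+∣q∣ p q))
∣p∩q∣+∣p∪q∣≡∣p∣+∣q∣ (false ∷ p) (true ∷ q) =
  trans (+-suc _ _) (trans (cong suc (∣p∩q∣+∣p∪q∣≡∣p∣+∣q∣ p q)) (sym (+-suc _ _)))
∣p∩q∣+∣p∪q∣≡∣p∣+∣q∣ (false ∷ p) (false ∷ q) = ∣p∩q∣+∣p∪q∣≡∣p∣+∣q∣ p q

subset-of-size : ∀ {n j} → j ≤ℕ n → Σ[ p ∈ Subset n ] ∣ p ∣ ≡ j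
subset-of-size {n} z≤n = ⊥ , ∣⊥∣≡0 n
subset-of-size (s≤s j≤n) with subset-of-size j≤n
... | p , ∣p∣≡j = inside ∷ p , cong suc ∣p∣≡j

WeakSubmodularityInequality : ∀ {n} → SetFun n → Subset n → Subset n → Set
WeakSubmodularityInequality f S T =
  (ℕ→ℚ ∣ S ∩ T ∣ ℚ.* f (S ∪ T)) ℚ.+ (ℕ→ℚ ∣ S ∪ T ∣ ℚ.* f (S ∩ T))
    ℚ.≤ (ℕ→ℚ ∣ T ∣ ℚ.* f S) ℚ.+ (ℕ→ℚ ∣ S ∣ ℚ.* f T)

ℕ→ℚ-*-threshold : ∀ B k x {n} (p : Subset n) →
  ℕ→ℚ x ℚ.* threshold B k p ≡ ℕ→ℚ (x when (k ≤ᵇ ∣ p ∣)) ℚ.* B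
ℕ→ℚ-*-threshold B k x p with k ≤ᵇ ∣ p ∣
... | true = refl
... | false = trans (ℚₚ.*-zeroʳ (ℕ→ℚ x)) (sym (ℚₚ.*-zeroˡ B))

ℕ→ℚ-*-threshold-+ : ∀ B k x y {n} (p q : Subset n) →
  ℕ→ℚ x ℚ.* threshold B k p ℚ.+ ℕ→ℚ y ℚ.* threshold B k q
    ≡ ℕ→ℚ ((x when (k ≤ᵇ ∣ p ∣)) + (y when (k ≤ᵇ ∣ q ∣))) ℚ.* B
ℕ→ℚ-*-threshold-+ B k x y p q = begin
  ℕ→ℚ x ℚ.* threshold B k p ℚ.+ ℕ→ℚ y ℚ.* threshold B k q
    ≡⟨ cong₂ ℚ._+_ (ℕ→ℚ-*-threshold B k x p) (ℕ→ℚ-*-threshold B k y q) ⟩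
  ℕ→ℚ x′ ℚ.* B ℚ.+ ℕ→ℚ y′ ℚ.* B
    ≡⟨ ℚₚ.*-distribʳ-+ B (ℕ→ℚ x′) (ℕ→ℚ y′) ⟨
  (ℕ→ℚ x′ ℚ.+ ℕ→ℚ y′) ℚ.* B
    ≡⟨ cong (ℚ._* B) (ℕ→ℚ-+ x′ y′) ⟨
  ℕ→ℚ (x′ + y′) ℚ.* B ∎
  where
  open ≡-Reasoning
  x′ = x when (k ≤ᵇ ∣ p ∣)
  y′ = y when (k ≤ᵇ ∣ q ∣)

threshold-inequality⇔ : ∀ {B} → 0ℚ < B → ∀ k {n} (S T : Subset n) →
  WeakSubmodularityInequality (threshold B k) S T
    ⇔ ThresholdInequality k (∣ S ∩ T ∣) (∣ S ∪ T ∣) (∣ S ∣) (∣ T ∣)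
threshold-inequality⇔ {B} 0<B k S T = mk⇔
  (λ le → ℕ→ℚ-cancel-≤ (ℚₚ.*-cancelʳ-≤-pos B {{B>0}} (subst₂ ℚ._≤_ lhs rhs le)))
  (λ le → subst₂ ℚ._≤_ (sym lhs) (sym rhs)
    (ℚₚ.*-monoʳ-≤-nonNeg B {{ℚₚ.pos⇒nonNeg B {{B>0}}}} (ℕ→ℚ-mono-≤ le)))
  where
  B>0 = positive 0<B
  lhs = ℕ→ℚ-*-threshold-+ B k (∣ S ∩ T ∣) (∣ S ∪ T ∣) (S ∪ T) (S ∩ T)
  rhs = ℕ→ℚ-*-threshold-+ B k (∣ T ∣) (∣ S ∣) S T

threshold-below : ∀ B k {n} (p : Subset n) → ∣ p ∣ <ℕ k → threshold B k p ≡ 0ℚ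
threshold-below B k p ∣p∣<k with k ≤ᵇ ∣ p ∣ | ≤ᵇ⇒≤ k ∣ p ∣
... | false | _ = refl
... | true | k≤∣p∣ = ⊥-elim (<⇒≱ ∣p∣<k (k≤∣p∣ _))

threshold-nonNegative : ∀ {B} → 0ℚ ℚ.≤ B → ∀ k {n} (p : Subset n) → 0ℚ ℚ.≤ threshold B k p
threshold-nonNegative 0≤B k p with k ≤ᵇ ∣ p ∣
... | true = 0≤B
... | false = ℚₚ.≤-refl

threshold-weaklySubmodular : ∀ {B} → 0ℚ < B → ∀ {k} → 1 ≤ℕ k → k ≤ℕ 2 →
  ∀ n → WeaklySubmodular n (threshold B k)
threshold-weaklySubmodular {B} 0<B {k} 1≤k k≤2 n =
  threshold-below B k (⊥ {n}) (subst (_<ℕ k) (sym (∣⊥∣≡0 n)) 1≤k) ,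
  threshold-nonNegative (ℚₚ.<⇒≤ 0<B) k ,
  λ S T → Equivalence.from (threshold-inequality⇔ 0<B k S T)
    (thresholdInequality (∣p∩q∣+∣p∪q∣≡∣p∣+∣q∣ S T) (∣p∩q∣≤∣p∣ S T) (∣p∩q∣≤∣q∣ S T)
      (∣p∣≤∣p∪q∣ S T) (straddle⇒a≡0 k≤2 (∣p∩q∣+∣p∪q∣≡∣p∣+∣q∣ S T)))

threshold-not-weaklySubmodular : ∀ {B} → 0ℚ < B → ∀ {k n} → 3 ≤ℕ k → k ≤ℕ n →
  ¬ WeaklySubmodular n (threshold B k)
threshold-not-weaklySubmodular 0<B {suc (suc j)} (s≤s (s≤s 1≤j)) (s≤s (s≤s j≤n))
  (_ , _ , weaklySubmodular) with subset-of-size j≤n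
... | P , ∣P∣≡j = ¬thresholdInequality ∣S∣<k ∣S∣<k k≤∣S∪T∣ 1≤∣S∩T∣
  (Equivalence.to (threshold-inequality⇔ 0<B _ S T) (weaklySubmodular S T))
  where
  S T : Subset _
  S = outside ∷ inside ∷ P
  T = inside ∷ outside ∷ P
  ∣S∣<k : ∣ S ∣ <ℕ suc (suc j)
  ∣S∣<k = ≤-reflexive (cong (λ x → 2 + x) ∣P∣≡j)
  k≤∣S∪T∣ : suc (suc j) ≤ℕ ∣ S ∪ T ∣
  k≤∣S∪T∣ = ≤-reflexive (cong (λ x → 2 + x) (sym (trans (cong ∣_∣ (∪-idem P)) ∣P∣≡j)))
  1≤∣S∩T∣ : 1 ≤ℕ ∣ S ∩ T ∣
  1≤∣S∩T∣ = subst (1 ≤ℕ_) (sym (trans (cong ∣_∣ (∩-idem P)) ∣P∣≡j)) 1≤j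

proposition5 : (B : ℚ) → 0ℚ < B →
    ((n : ℕ) → WeaklySubmodular n (threshold B 1) × WeaklySubmodular n (threshold B 2))
    × ((k : ℕ) → 3 ≤ℕ k → (n : ℕ) → k ≤ℕ n → ¬ WeaklySubmodular n (threshold B k))
proposition5 B 0<B =
  (λ n → threshold-weaklySubmodular 0<B (s≤s z≤n) (s≤s z≤n) n ,
         threshold-weaklySubmodular 0<B (s≤s z≤n) ≤-refl n) ,
  λ k 3≤k n k≤n → threshold-not-weaklySubmodular 0<B 3≤k k≤n
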